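{- Let $G$ be a finite simple $2$-edge connected graph and let $k \geq 3$ be an integer. If the degree of every vertex of $G$ is divisible by $k$, then every edge of $G$ is contained in a circuit of even length.
   Context: Graphs are finite, simple (no loops, no multiple edges). A graph is $2$-edge connected if it is connected and remains connected whenever fewer than $2$ edges are removed. A walk is a sequence $v_0, e_1, v_1, \ldots, e_k, v_k$ of vertices and edges with $e_i$ having endpoints $v_{i-1}, v_i$; a trail is a walk with no repeated edge; a circuit is a trail whose first and last vertices coincide (vertices may repeat). The length of a circuit is its number of edges. -}

module Defs where

open import Data.Nat using (ℕ; zero; suc; _+_)
open import Data.Bool using (Bool; true; false; _∧_; _∨_; not; if_then_else_)
open import Data.Fin using (Fin; _≟_)
open import Data.Product using (_×_; _,_; Σ)
open import Data.Sum using (_⊎_)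
open import Data.List using (List; []; _∷_; length; map; allFin)
open import Data.Nat.ListAction using (sum)
open import Data.List.Relation.Unary.AllPairs using (AllPairs)
open import Data.List.Relation.Unary.Any using (Any)
open import Relation.Binary.PropositionalEquality using (_≡_)
open import Relation.Nullary using (¬_)
open import Relation.Nullary.Decidable using (⌊_⌋)

record Graph (n : ℕ) : Set where
  field
    adj    : Fin n → Fin n → Bool
    sym    : ∀ i j → adj i j ≡ adj j i
    irrefl : ∀ i → adj i i ≡ false
open Graph public

deg : ∀ {n} → Graph n → Fin n → ℕ
deg {n} G i = sum (map (λ j → if adj G i j then 1 else 0) (allFin n))

-- Walks with respect to an adjacency relation A (simple graph: an edge is
-- determined by its endpoints).
data Walk {n : ℕ} (A : Fin n → Fin n → Bool) : Fin n → Fin n → Set where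
  here : ∀ v → Walk A v v
  step : ∀ {u v w} → A u v ≡ true → Walk A v w → Walk A u w

edges : ∀ {n} {A : Fin n → Fin n → Bool} {u v} → Walk A u v → List (Fin n × Fin n)
edges (here _) = []
edges (step {u} {v} _ w) = (u , v) ∷ edges w

SameEdge : ∀ {n} → Fin n × Fin n → Fin n × Fin n → Set
SameEdge (a , b) (c , d) = (a ≡ c × b ≡ d) ⊎ (a ≡ d × b ≡ c)

IsTrail : ∀ {n} {A : Fin n → Fin n → Bool} {u v} → Walk A u v → Set
IsTrail w = AllPairs (λ e f → ¬ SameEdge e f) (edges w)

Connected : ∀ {n} → (Fin n → Fin n → Bool) → Set
Connected A = ∀ u v → Walk A u v

removeEdge : ∀ {n} → Fin n → Fin n → (Fin n → Fin n → Bool) → Fin n → Fin n → Bool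
removeEdge a b A i j =
  A i j ∧ not ((⌊ i ≟ a ⌋ ∧ ⌊ j ≟ b ⌋) ∨ (⌊ i ≟ b ⌋ ∧ ⌊ j ≟ a ⌋))

TwoEdgeConnected : ∀ {n} → Graph n → Set
TwoEdgeConnected G =
  Connected (adj G) × (∀ a b → adj G a b ≡ true → Connected (removeEdge a b (adj G)))

record Circuit {n : ℕ} (G : Graph n) : Set where
  field
    base  : Fin n
    walk  : Walk (adj G) base base
    trail : IsTrail walk

circuitLength : ∀ {n} {G : Graph n} → Circuit G → ℕ
circuitLength c = length (edges (Circuit.walk c))

OnCircuit : ∀ {n} {G : Graph n} → Fin n → Fin n → Circuit G → Set
OnCircuit a b c = Any (SameEdge (a , b)) (edges (Circuit.walk c))

-- Let H = G ∖ ab; H is connected since G has no bridge.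
--
-- If H is bipartite, colour it with b in class 0. Were a also in class 0, then ab would be the only edge
-- inside a class, so the degree sums of the two classes, both multiples of k, would differ by exactly 2,
-- contradicting k ≥ 3. Hence a lies in class 1, every b–a path of H is odd, and ab closes one into an
-- even cycle.
--
-- Otherwise H contains an odd circuit D. Keep a "dumbbell": a circuit C through ab, a bar Q from C to D,
-- all edge-disjoint. If Q is trivial, C meets D, and C or C followed by D is an even circuit. Otherwise
-- the first edge of Q is no bridge, and a detour around it leads from D ∪ Q back to C. If it leaves from
-- D, it combines with an arc of C through ab, the bar and one of the two arcs of D (chosen by parity)
-- into an even circuit through ab; if it leaves from Q, it yields a new dumbbell with a shorter bar.

module Submission where

open import Defs
open import Data.Nat using (ℕ; _≤_)
open import Data.Nat.Divisibility using (_∣_)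
open import Data.Fin using (Fin)
open import Data.Bool using (true)
open import Data.Product using (Σ; _×_)
open import Relation.Binary.PropositionalEquality using (_≡_)

open import Data.Bool using (Bool; false; not; _∧_; if_then_else_)
import Data.Bool as Bool
open import Data.Empty using (⊥-elim)
open import Data.Fin using (_≟_; zero; suc; punchIn)
open import Data.Fin.Properties using (any?; punchInᵢ≢i)
open import Data.List using (List; []; _∷_; _++_; length; tabulate)
open import Data.List.Membership.Propositional using (_∈_; _∉_; find; lose)
open import Data.List.Membership.Propositional.Properties using (∈-++⁺ˡ; ∈-++⁺ʳ; ∈-++⁻)
import Data.List.Membership.DecPropositional as DecMembership
open import Data.List.Properties using (map-tabulate)
open import Data.List.Relation.Binary.Subset.Propositional using (_⊆_)
open import Data.List.Relation.Unary.All as All using (All)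
open import Data.List.Relation.Unary.AllPairs using (AllPairs; []; _∷_)
import Data.List.Relation.Unary.AllPairs.Properties as AllPairs
open import Data.List.Relation.Unary.Any as Any using (Any; here; there)
import Data.List.Relation.Unary.Any.Properties as Anyₚ
open import Data.List.Relation.Unary.Unique.Propositional using (Unique)
open import Data.Nat using (zero; suc; _+_; _*_; s≤s; z≤n)
open import Data.Nat.Base using (parity)
open import Data.Nat.Divisibility using (divides; _∣0; ∣m∣n⇒∣m+n; ∣m+n∣m⇒∣n; ∣n⇒∣m*n; ∣⇒≤)
import Data.Nat.ListAction as ListAction
open import Data.Nat.Properties
  using (+-comm; +-suc; ≤-refl; ≤-trans; ≤-reflexive; m≤m+n; m≤n+m; +-monoʳ-≤; +-monoˡ-≤; *-identityʳ;
         +-commutativeSemigroup; +-*-semiring; module ≤-Reasoning)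
open import Algebra.Properties.CommutativeSemigroup +-commutativeSemigroup using (x∙yz≈y∙xz)
open import Data.Parity.Base using (Parity; 0ℙ; 1ℙ; _⁻¹)
import Data.Parity.Base as ℙ
import Data.Parity.Properties as ℙ
open import Data.Parity.Properties using (+-homo-+; p≢p⁻¹; p+p≡0ℙ; p+p⁻¹≡1ℙ; ⁻¹-involutive)
open import Data.Product using (_,_; proj₁; proj₂; ∃-syntax; swap)
open import Data.Sum as Sum using (_⊎_; inj₁; inj₂; [_,_]′)
open import Function using (_∘_; id)
open import Relation.Nullary using (¬_; Dec; yes; no)
open import Relation.Nullary.Decidable using (_×-dec_; _⊎-dec_; ⌊_⌋; isYes≗does; dec-true; dec-false)
open import Relation.Binary.PropositionalEquality as ≡
  using (_≢_; refl; trans; cong; cong₂; subst; module ≡-Reasoning)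
open import Algebra.Properties.Semiring.Sum +-*-semiring
  using (sum; sum-syntax; ∑-distrib-+; ∑-comm; *-distribˡ-sum; sum-cong-≗; sum-remove; sum-replicate-zero)

p≢q⇒q≡p⁻¹ : ∀ {p q} → p ≢ q → q ≡ p ⁻¹
p≢q⇒q≡p⁻¹ {0ℙ} {0ℙ} p≢q = ⊥-elim (p≢q refl)
p≢q⇒q≡p⁻¹ {0ℙ} {1ℙ} _   = refl
p≢q⇒q≡p⁻¹ {1ℙ} {0ℙ} _   = refl
p≢q⇒q≡p⁻¹ {1ℙ} {1ℙ} p≢q = ⊥-elim (p≢q refl)

[p⁻¹+q]⁻¹≡p+q : ∀ p q → (p ⁻¹ ℙ.+ q) ⁻¹ ≡ p ℙ.+ q
[p⁻¹+q]⁻¹≡p+q 0ℙ q = ⁻¹-involutive q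
[p⁻¹+q]⁻¹≡p+q 1ℙ q = refl

parity-suc : ∀ m → parity (suc m) ≡ parity m ⁻¹
parity-suc m = +-homo-+ 1 m

parity-odd-+ : ∀ m k → parity (m + k) ≡ 1ℙ → parity m ≡ 1ℙ ⊎ parity k ≡ 1ℙ
parity-odd-+ m k odd rewrite +-homo-+ m k with parity m | parity k
... | 1ℙ | _  = inj₁ refl
... | 0ℙ | 1ℙ = inj₂ refl
... | 0ℙ | 0ℙ = ⊥-elim (p≢p⁻¹ 0ℙ odd)

parity-even-choice : ∀ m k₁ k₂ → parity (k₁ + k₂) ≡ 1ℙ →
  parity (m + k₁) ≡ 0ℙ ⊎ parity (m + k₂) ≡ 0ℙ
parity-even-choice m k₁ k₂ odd
  rewrite +-homo-+ k₁ k₂ | +-homo-+ m k₁ | +-homo-+ m k₂ with parity m | parity k₁ | parity k₂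
... | 0ℙ | 0ℙ | _  = inj₁ refl
... | 0ℙ | 1ℙ | 0ℙ = inj₂ refl
... | 1ℙ | 1ℙ | _  = inj₁ refl
... | 1ℙ | 0ℙ | 1ℙ = inj₂ refl
... | 0ℙ | 1ℙ | 1ℙ = ⊥-elim (p≢p⁻¹ 0ℙ odd)
... | 1ℙ | 0ℙ | 0ℙ = ⊥-elim (p≢p⁻¹ 0ℙ odd)

parity≡0ℙ⇒2∣ : ∀ m → parity m ≡ 0ℙ → 2 ∣ m
parity≡0ℙ⇒2∣ zero          _    = divides 0 refl
parity≡0ℙ⇒2∣ (suc (suc m)) even with parity≡0ℙ⇒2∣ m even
... | divides q m≡q*2 = divides (suc q) (cong (2 +_) m≡q*2)

Edge : ℕ → Set
Edge n = Fin n × Fin n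

module _ {n : ℕ} where

  SameEdge-refl : (e : Edge n) → SameEdge e e
  SameEdge-refl _ = inj₁ (refl , refl)

  SameEdge-sym : {e f : Edge n} → SameEdge e f → SameEdge f e
  SameEdge-sym {_ , _} {_ , _} (inj₁ (refl , refl)) = inj₁ (refl , refl)
  SameEdge-sym {_ , _} {_ , _} (inj₂ (refl , refl)) = inj₂ (refl , refl)

  SameEdge-swap : {e f : Edge n} → SameEdge e f → SameEdge (swap e) f
  SameEdge-swap {_ , _} {_ , _} (inj₁ (refl , refl)) = inj₂ (refl , refl)
  SameEdge-swap {_ , _} {_ , _} (inj₂ (refl , refl)) = inj₁ (refl , refl)

  swap-SameEdge : (e : Edge n) → SameEdge (swap e) e
  swap-SameEdge (_ , _) = inj₂ (refl , refl)

  SameEdge-trans : {e f g : Edge n} → SameEdge e f → SameEdge f g → SameEdge e g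
  SameEdge-trans {_ , _} {_ , _} (inj₁ (refl , refl)) s = s
  SameEdge-trans {_ , _} {_ , _} (inj₂ (refl , refl)) s = SameEdge-swap s

  sameEdge? : (e f : Edge n) → Dec (SameEdge e f)
  sameEdge? (i , j) (a , b) = (i ≟ a ×-dec j ≟ b) ⊎-dec (i ≟ b ×-dec j ≟ a)

  -- ⌊_⌋ is isYes, which does not commute with _×-dec_ and _⊎-dec_ by computation; does does.
  removeEdge-unfold : ∀ a b (A : Fin n → Fin n → Bool) i j →
    removeEdge a b A i j ≡ A i j ∧ not ⌊ sameEdge? (i , j) (a , b) ⌋
  removeEdge-unfold a b A i j
    rewrite isYes≗does (i ≟ a) | isYes≗does (j ≟ b) | isYes≗does (i ≟ b) | isYes≗does (j ≟ a)
          | isYes≗does (sameEdge? (i , j) (a , b)) = refl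

  EdgeDisjoint : List (Edge n) → List (Edge n) → Set
  EdgeDisjoint es fs = ∀ {e f} → e ∈ es → f ∈ fs → ¬ SameEdge e f

  infix 4 _⊑_
  _⊑_ : List (Edge n) → List (Edge n) → Set
  es ⊑ fs = ∀ {e} → e ∈ es → Any (SameEdge e) fs

  Inside : (Fin n → Set) → List (Edge n) → Set
  Inside P es = ∀ {e} → e ∈ es → P (proj₁ e) × P (proj₂ e)

  Distinct : List (Edge n) → Set
  Distinct = AllPairs (λ e f → ¬ SameEdge e f)

  private variable
    e f : Edge n
    es fs es′ fs′ : List (Edge n)

  ⊆⇒⊑ : es ⊆ fs → es ⊑ fs
  ⊆⇒⊑ sub e∈ = lose (sub e∈) (SameEdge-refl _)

  ⊑-refl : es ⊑ es
  ⊑-refl e∈ = lose e∈ (SameEdge-refl _)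

  Any-SameEdge-⊑ : Any (SameEdge e) es → es ⊑ fs → Any (SameEdge e) fs
  Any-SameEdge-⊑ e~ sub with find e~
  ... | e′ , e′∈ , s with find (sub e′∈)
  ...   | f , f∈ , s′ = lose f∈ (SameEdge-trans s s′)

  ⊑-trans : es ⊑ fs → fs ⊑ fs′ → es ⊑ fs′
  ⊑-trans sub sub′ e∈ = Any-SameEdge-⊑ (sub e∈) sub′

  Inside-⊑ : {P : Fin n → Set} → es ⊑ fs → Inside P fs → Inside P es
  Inside-⊑ sub ins e∈ with find (sub e∈)
  ... | (_ , _) , f∈ , inj₁ (refl , refl) = ins f∈
  ... | (_ , _) , f∈ , inj₂ (refl , refl) = swap (ins f∈)

  EdgeDisjoint-sym : EdgeDisjoint es fs → EdgeDisjoint fs es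
  EdgeDisjoint-sym dis f∈ e∈ s = dis e∈ f∈ (SameEdge-sym s)

  EdgeDisjoint-anti : es′ ⊑ es → fs′ ⊑ fs → EdgeDisjoint es fs → EdgeDisjoint es′ fs′
  EdgeDisjoint-anti se sf dis e∈ f∈ s with find (se e∈) | find (sf f∈)
  ... | _ , e∈′ , s₁ | _ , f∈′ , s₂ =
    dis e∈′ f∈′ (SameEdge-trans (SameEdge-sym s₁) (SameEdge-trans s s₂))

  EdgeDisjoint-++ʳ : EdgeDisjoint es fs → EdgeDisjoint es fs′ → EdgeDisjoint es (fs ++ fs′)
  EdgeDisjoint-++ʳ {fs = fs} dis dis′ e∈ f∈ with ∈-++⁻ fs f∈
  ... | inj₁ f∈₁ = dis e∈ f∈₁
  ... | inj₂ f∈₂ = dis′ e∈ f∈₂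

  ¬SameEdge-source-outside : {P : Fin n → Set} → ¬ P (proj₁ e) → P (proj₁ f) × P (proj₂ f) → ¬ SameEdge e f
  ¬SameEdge-source-outside {_ , _} {_ , _} out (p₁ , _) (inj₁ (refl , refl)) = out p₁
  ¬SameEdge-source-outside {_ , _} {_ , _} out (_ , p₂) (inj₂ (refl , refl)) = out p₂

  sources-outside⇒EdgeDisjoint : {P : Fin n → Set} →
    (∀ {e} → e ∈ es → ¬ P (proj₁ e)) → Inside P fs → EdgeDisjoint es fs
  sources-outside⇒EdgeDisjoint out ins e∈ f∈ = ¬SameEdge-source-outside (out e∈) (ins f∈)

  targets-outside⇒EdgeDisjoint : {P : Fin n → Set} →
    (∀ {e} → e ∈ es → ¬ P (proj₂ e)) → Inside P fs → EdgeDisjoint es fs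
  targets-outside⇒EdgeDisjoint out ins e∈ f∈ s = ¬SameEdge-source-outside (out e∈) (ins f∈) (SameEdge-swap s)

  swap-⊑ : (e : Edge n) → (swap e ∷ []) ⊑ (e ∷ [])
  swap-⊑ e (here refl) = here (swap-SameEdge e)

  All⇒EdgeDisjoint : All (λ f → ¬ SameEdge e f) fs → EdgeDisjoint (e ∷ []) fs
  All⇒EdgeDisjoint e# (here refl) f∈ = All.lookup e# f∈

  Distinct-++⁺ : Distinct es → Distinct fs → EdgeDisjoint es fs → Distinct (es ++ fs)
  Distinct-++⁺ des dfs dis = AllPairs.++⁺ des dfs (All.tabulate λ e∈ → All.tabulate λ f∈ → dis e∈ f∈)

  Distinct-++⁻ : ∀ es → Distinct (es ++ fs) → Distinct es × Distinct fs × EdgeDisjoint es fs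
  Distinct-++⁻ [] d = [] , d , λ ()
  Distinct-++⁻ (e ∷ es) (e# ∷ d) with Distinct-++⁻ es d
  ... | des , dfs , dis =
    All.tabulate (λ x∈ → All.lookup e# (∈-++⁺ˡ x∈)) ∷ des , dfs ,
    λ { (here refl) f∈ → All.lookup e# (∈-++⁺ʳ es f∈) ; (there e∈) f∈ → dis e∈ f∈ }

module _ {n : ℕ} {A : Fin n → Fin n → Bool} where

  private variable
    u v w x y z : Fin n

  infixr 5 _++ʷ_
  _++ʷ_ : Walk A u v → Walk A v w → Walk A u w
  here _   ++ʷ q = q
  step e p ++ʷ q = step e (p ++ʷ q)

  len : Walk A u v → ℕ
  len p = length (edges p)

  edges-++ʷ : (p : Walk A u v) (q : Walk A v w) → edges (p ++ʷ q) ≡ edges p ++ edges q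
  edges-++ʷ (here _)   q = refl
  edges-++ʷ (step _ p) q = cong (_ ∷_) (edges-++ʷ p q)

  len-++ʷ : (p : Walk A u v) (q : Walk A v w) → len (p ++ʷ q) ≡ len p + len q
  len-++ʷ (here _)   q = refl
  len-++ʷ (step _ p) q = cong suc (len-++ʷ p q)

  ++ʷ-assoc : (p : Walk A u v) (q : Walk A v w) (r : Walk A w x) → (p ++ʷ q) ++ʷ r ≡ p ++ʷ (q ++ʷ r)
  ++ʷ-assoc (here _)   q r = refl
  ++ʷ-assoc (step e p) q r = cong (step e) (++ʷ-assoc p q r)

  ++ʷ-assoc³ : ∀ {y′} (p : Walk A u v) (q : Walk A v w) (r : Walk A w x) (s : Walk A x y′) →
               (p ++ʷ q ++ʷ r) ++ʷ s ≡ p ++ʷ q ++ʷ r ++ʷ s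
  ++ʷ-assoc³ p q r s = trans (++ʷ-assoc p (q ++ʷ r) s) (cong (p ++ʷ_) (++ʷ-assoc q r s))

  verts : Walk A u v → List (Fin n)
  verts (here v)       = v ∷ []
  verts (step {u} _ p) = u ∷ verts p

  start∈verts : (p : Walk A u v) → u ∈ verts p
  start∈verts (here _)   = here refl
  start∈verts (step _ _) = here refl

  end∈verts : (p : Walk A u v) → v ∈ verts p
  end∈verts (here _)   = here refl
  end∈verts (step _ p) = there (end∈verts p)

  ∈-verts-++ʷ⁺ʳ : (p : Walk A u v) (q : Walk A v w) → x ∈ verts q → x ∈ verts (p ++ʷ q)
  ∈-verts-++ʷ⁺ʳ (here _)   q x∈ = x∈
  ∈-verts-++ʷ⁺ʳ (step _ p) q x∈ = there (∈-verts-++ʷ⁺ʳ p q x∈)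

  ∈-verts-++ʷ⁻ : (p : Walk A u v) (q : Walk A v w) → x ∈ verts (p ++ʷ q) → x ∈ verts p ⊎ x ∈ verts q
  ∈-verts-++ʷ⁻ (here _)   q x∈          = inj₂ x∈
  ∈-verts-++ʷ⁻ (step _ p) q (here refl) = inj₁ (here refl)
  ∈-verts-++ʷ⁻ (step _ p) q (there x∈)  = Sum.map₁ there (∈-verts-++ʷ⁻ p q x∈)

  edges-inside-verts : (p : Walk A u v) → Inside (_∈ verts p) (edges p)
  edges-inside-verts (step _ p) (here refl) = here refl , there (start∈verts p)
  edges-inside-verts (step _ p) (there e∈) with edges-inside-verts p e∈
  ... | s∈ , t∈ = there s∈ , there t∈

  splitAt : (p : Walk A u v) → x ∈ verts p → Σ (Walk A u x) λ p₁ → Σ (Walk A x v) λ p₂ → p ≡ p₁ ++ʷ p₂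
  splitAt (here _)   (here refl) = here _ , here _ , refl
  splitAt (step e p) (here refl) = here _ , step e p , refl
  splitAt (step e p) (there x∈) with splitAt p x∈
  ... | p₁ , p₂ , refl = step e p₁ , p₂ , refl

  trail-++ʷ⁺ : (p : Walk A u v) (q : Walk A v w) → IsTrail p → IsTrail q →
               EdgeDisjoint (edges p) (edges q) → IsTrail (p ++ʷ q)
  trail-++ʷ⁺ p q tp tq dis = subst Distinct (≡.sym (edges-++ʷ p q)) (Distinct-++⁺ tp tq dis)

  trail-++ʷ⁻ : (p : Walk A u v) (q : Walk A v w) → IsTrail (p ++ʷ q) →
               IsTrail p × IsTrail q × EdgeDisjoint (edges p) (edges q)
  trail-++ʷ⁻ p q t = Distinct-++⁻ (edges p) (subst Distinct (edges-++ʷ p q) t)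

  EdgeDisjoint-++ʷʳ : ∀ {es} (p : Walk A u v) (q : Walk A v w) →
    EdgeDisjoint es (edges p) → EdgeDisjoint es (edges q) → EdgeDisjoint es (edges (p ++ʷ q))
  EdgeDisjoint-++ʷʳ p q dp dq e∈ f∈ = EdgeDisjoint-++ʳ dp dq e∈ (subst (_ ∈_) (edges-++ʷ p q) f∈)

  IsPath : Walk A u v → Set
  IsPath p = Unique (verts p)

  ∉⇒path-step : (e : A u v ≡ true) (p : Walk A v w) → u ∉ verts p → IsPath p → IsPath (step e p)
  ∉⇒path-step e p u∉ π = All.tabulate (λ x∈ u≡x → u∉ (subst (_∈ verts p) (≡.sym u≡x) x∈)) ∷ π

  path-++ʷ⁻ʳ : (p : Walk A u v) (q : Walk A v w) → IsPath (p ++ʷ q) → IsPath q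
  path-++ʷ⁻ʳ (here _)   q π       = π
  path-++ʷ⁻ʳ (step _ p) q (_ ∷ π) = path-++ʷ⁻ʳ p q π

  path⇒trail : (p : Walk A u v) → IsPath p → IsTrail p
  path⇒trail (here _)   _        = []
  path⇒trail (step _ p) (u∉ ∷ π) =
    All.tabulate (λ e∈ → ¬SameEdge-source-outside {P = _∈ verts p} (λ u∈ → All.lookup u∉ u∈ refl) (edges-inside-verts p e∈))
    ∷ path⇒trail p π

  edges-++ʷ⁺ˡ : (p : Walk A u v) (q : Walk A v w) → edges p ⊆ edges (p ++ʷ q)
  edges-++ʷ⁺ˡ p q e∈ = subst (_ ∈_) (≡.sym (edges-++ʷ p q)) (∈-++⁺ˡ e∈)

  edges-++ʷ⁺ʳ : (p : Walk A u v) (q : Walk A v w) → edges q ⊆ edges (p ++ʷ q)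
  edges-++ʷ⁺ʳ p q e∈ = subst (_ ∈_) (≡.sym (edges-++ʷ p q)) (∈-++⁺ʳ (edges p) e∈)

  open DecMembership (_≟_ {n}) using (_∈?_)

  shortcut : (p : Walk A u v) → Σ (Walk A u v) λ q → IsPath q × edges q ⊆ edges p
  shortcut (here v) = here v , All.[] ∷ [] , λ ()
  shortcut (step {u} e p) with shortcut p
  ... | q , π , q⊆p with u ∈? verts q
  ...   | no u∉ = step e q , ∉⇒path-step e q u∉ π , λ { (here refl) → here refl ; (there e∈) → there (q⊆p e∈) }
  ...   | yes u∈ with splitAt q u∈
  ...     | q₁ , q₂ , refl = q₂ , path-++ʷ⁻ʳ q₁ q₂ π , λ e∈ → there (q⊆p (edges-++ʷ⁺ʳ q₁ q₂ e∈))

  rotate : (W : Walk A u u) → IsTrail W → x ∈ verts W →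
           Σ (Walk A x x) λ W′ → IsTrail W′ × len W′ ≡ len W × edges W′ ⊆ edges W
  rotate W t x∈ with splitAt W x∈
  ... | W₁ , W₂ , refl with trail-++ʷ⁻ W₁ W₂ t
  ...   | t₁ , t₂ , dis =
    W₂ ++ʷ W₁ , trail-++ʷ⁺ W₂ W₁ t₂ t₁ (EdgeDisjoint-sym dis) ,
    trans (len-++ʷ W₂ W₁) (trans (+-comm (len W₂) (len W₁)) (≡.sym (len-++ʷ W₁ W₂))) ,
    λ e∈ → [ edges-++ʷ⁺ʳ W₁ W₂ , edges-++ʷ⁺ˡ W₁ W₂ ]′ (∈-++⁻ (edges W₂) (subst (_ ∈_) (edges-++ʷ W₂ W₁) e∈))

  module _ {P : Fin n → Set} (P? : ∀ v → Dec (P v)) where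

    firstHit : (p : Walk A u v) → P v →
      ∃[ z ] P z × Σ (Walk A u z) λ q → (∀ {e} → e ∈ edges q → ¬ P (proj₁ e)) × edges q ⊆ edges p
    firstHit (here v) pv = v , pv , here v , (λ ()) , (λ ())
    firstHit (step {u} e p) pv with P? u
    ... | yes pu = u , pu , here u , (λ ()) , (λ ())
    ... | no ¬pu with firstHit p pv
    ...   | z , pz , q , out , q⊆p =
      z , pz , step e q , (λ { (here refl) → ¬pu ; (there e∈) → out e∈ }) ,
      λ { (here refl) → here refl ; (there e∈) → there (q⊆p e∈) }

    lastHit : (p : Walk A u v) → P u →
      ∃[ z ] P z × Σ (Walk A z v) λ q → (∀ {e} → e ∈ edges q → ¬ P (proj₂ e)) × edges q ⊆ edges p
    lastHit p pu = go p (lose (start∈verts p) pu)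
      where
      go : ∀ {u v} (p : Walk A u v) → Any P (verts p) →
        ∃[ z ] P z × Σ (Walk A z v) λ q → (∀ {e} → e ∈ edges q → ¬ P (proj₂ e)) × edges q ⊆ edges p
      go (here v) (here pv) = v , pv , here v , (λ ()) , (λ ())
      go (step {u} e p) hit with Any.any? P? (verts p) | hit
      ... | yes hit′ | _ with go p hit′
      ...   | z , pz , q , out , q⊆p = z , pz , q , out , λ e∈ → there (q⊆p e∈)
      go (step {u} e p) hit | no miss | here pu =
        u , pu , step e p ,
        (λ { (here refl) pv → miss (lose (start∈verts p) pv)
           ; (there e∈) pt → miss (lose (proj₂ (edges-inside-verts p e∈)) pt) }) ,
        λ e∈ → e∈
      go (step {u} e p) hit | no miss | there hit′ = ⊥-elim (miss hit′)

  path⊎loop : (p : Walk A u v) → IsPath p ⊎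
    ∃[ y ] Σ (Walk A u y) λ p₁ → Σ (Walk A y y) λ ℓ → Σ (Walk A y v) λ p₂ →
      1 ≤ len ℓ × len p ≡ len p₁ + (len ℓ + len p₂)
  path⊎loop (here _) = inj₁ (All.[] ∷ [])
  path⊎loop (step {u} e p) with path⊎loop p
  ... | inj₂ (y , p₁ , ℓ , p₂ , ℓ≥1 , eq) = inj₂ (y , step e p₁ , ℓ , p₂ , ℓ≥1 , cong suc eq)
  ... | inj₁ π with u ∈? verts p
  ...   | no u∉ = inj₁ (∉⇒path-step e p u∉ π)
  ...   | yes u∈ with splitAt p u∈
  ...     | p₁ , p₂ , refl = inj₂ (u , here u , step e p₁ , p₂ , s≤s z≤n , cong suc (len-++ʷ p₁ p₂))

  path-sources≢end : (p : Walk A u v) → IsPath p → ∀ {e} → e ∈ edges p → proj₁ e ≢ v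
  path-sources≢end (step _ p) (u∉ ∷ _) (here refl) refl = All.lookup u∉ (end∈verts p) refl
  path-sources≢end (step _ p) (_ ∷ π)  (there e∈)       = path-sources≢end p π e∈

  closed-path-empty : (p : Walk A u u) → IsPath p → len p ≡ 0
  closed-path-empty (here _)   _        = refl
  closed-path-empty (step _ p) (u∉ ∷ _) = ⊥-elim (All.lookup u∉ (end∈verts p) refl)

  path-edge-start-end : (p : Walk A u v) → IsPath p → (u , v) ∈ edges p → len p ≡ 1
  path-edge-start-end (step _ p) (_ ∷ π)  (here refl) = cong suc (closed-path-empty p π)
  path-edge-start-end (step _ p) (u∉ ∷ _) (there e∈)  =
    ⊥-elim (All.lookup u∉ (proj₁ (edges-inside-verts p e∈)) refl)

  -- len p ≡ 1 would mean that p runs back along e.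
  cycle-trail : (e : A u v ≡ true) (p : Walk A v u) → IsPath p → len p ≢ 1 → IsTrail (step e p)
  cycle-trail {u} {v} e p π len≢1 = All.tabulate distinct ∷ path⇒trail p π
    where
    distinct : ∀ {g} → g ∈ edges p → ¬ SameEdge (u , v) g
    distinct {_ , _} g∈ (inj₁ (refl , refl)) = path-sources≢end p π g∈ refl
    distinct {_ , _} g∈ (inj₂ (refl , refl)) = len≢1 (path-edge-start-end p π g∈)

  oddClosedTrail : (W : Walk A u u) → parity (len W) ≡ 1ℙ →
    ∃[ y ] Σ (Walk A y y) λ D → IsTrail D × parity (len D) ≡ 1ℙ
  oddClosedTrail W = go (len W) W ≤-refl
    where
    go : ∀ m {x} (W : Walk A x x) → len W ≤ m → parity (len W) ≡ 1ℙ →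
         ∃[ y ] Σ (Walk A y y) λ D → IsTrail D × parity (len D) ≡ 1ℙ
    go (suc m) (step e W′) (s≤s ≤m) odd with path⊎loop W′
    ... | inj₁ π = _ , step e W′ , cycle-trail e W′ π W′≢1 , odd
      where
      W′≢1 : len W′ ≢ 1
      W′≢1 len≡1 = p≢p⁻¹ 0ℙ (trans (cong (parity ∘ suc) (≡.sym len≡1)) odd)
    ... | inj₂ (y , p₁ , ℓ , p₂ , ℓ≥1 , eq) with parity-odd-+ (len ℓ) (len M) (subst (λ l → parity l ≡ 1ℙ) split odd)
      where
      M = step e (p₁ ++ʷ p₂)
      split : suc (len W′) ≡ len ℓ + len M
      split = begin
        suc (len W′)                         ≡⟨ cong suc eq ⟩
        suc (len p₁ + (len ℓ + len p₂))      ≡⟨ cong suc (x∙yz≈y∙xz (len p₁) (len ℓ) (len p₂)) ⟩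
        suc (len ℓ + (len p₁ + len p₂))      ≡⟨ +-suc (len ℓ) _ ⟨
        len ℓ + suc (len p₁ + len p₂)        ≡⟨ cong (λ k → len ℓ + suc k) (len-++ʷ p₁ p₂) ⟨
        len ℓ + len M                        ∎
        where open ≡-Reasoning
    ...   | inj₁ oddℓ = go m ℓ (≤-trans ℓ≤W′ ≤m) oddℓ
      where
      ℓ≤W′ : len ℓ ≤ len W′
      ℓ≤W′ = ≤-trans (m≤m+n (len ℓ) (len p₂)) (≤-trans (m≤n+m _ (len p₁)) (≤-reflexive (≡.sym eq)))
    ...   | inj₂ oddM = go m (step e (p₁ ++ʷ p₂)) (≤-trans M≤W′ ≤m) oddM
      where
      M≤W′ : suc (len (p₁ ++ʷ p₂)) ≤ len W′
      M≤W′ = begin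
        suc (len (p₁ ++ʷ p₂))      ≡⟨ cong suc (len-++ʷ p₁ p₂) ⟩
        suc (len p₁ + len p₂)      ≡⟨ +-suc (len p₁) (len p₂) ⟨
        len p₁ + suc (len p₂)      ≤⟨ +-monoʳ-≤ (len p₁) (+-monoˡ-≤ (len p₂) ℓ≥1) ⟩
        len p₁ + (len ℓ + len p₂)  ≡⟨ eq ⟨
        len W′                     ∎
        where open ≤-Reasoning

module _ {n : ℕ} {A B : Fin n → Fin n → Bool} (A⇒B : ∀ {i j} → A i j ≡ true → B i j ≡ true) where

  mapWalk : ∀ {u v} → Walk A u v → Walk B u v
  mapWalk (here v)   = here v
  mapWalk (step e p) = step (A⇒B e) (mapWalk p)

  edges-mapWalk : ∀ {u v} (p : Walk A u v) → edges (mapWalk p) ≡ edges p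
  edges-mapWalk (here _)   = refl
  edges-mapWalk (step _ p) = cong (_ ∷_) (edges-mapWalk p)

module _ {n : ℕ} (G : Graph n) where

  private variable
    u v w x y z : Fin n

  adj-sym : ∀ {i j} → adj G i j ≡ true → adj G j i ≡ true
  adj-sym {i} {j} e = trans (Graph.sym G j i) e

  adj⇒≢ : ∀ {i j} → adj G i j ≡ true → i ≢ j
  adj⇒≢ {i} e refl with () ← trans (≡.sym e) (Graph.irrefl G i)

  rev : Walk (adj G) u v → Walk (adj G) v u
  rev (here v)   = here v
  rev (step e p) = rev p ++ʷ step (adj-sym e) (here _)

  len-rev : (p : Walk (adj G) u v) → len (rev p) ≡ len p
  len-rev (here _)   = refl
  len-rev (step e p) = trans (len-++ʷ (rev p) _) (trans (+-comm (len (rev p)) 1) (cong suc (len-rev p)))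

  ∈-edges-rev⁻ : (p : Walk (adj G) u v) → ∀ {e} → e ∈ edges (rev p) → swap e ∈ edges p
  ∈-edges-rev⁻ (step e p) e∈ with ∈-++⁻ (edges (rev p)) (subst (_ ∈_) (edges-++ʷ (rev p) _) e∈)
  ... | inj₁ e∈′        = there (∈-edges-rev⁻ p e∈′)
  ... | inj₂ (here refl) = here refl

  ∈-edges-rev⁺ : (p : Walk (adj G) u v) → ∀ {e} → e ∈ edges p → swap e ∈ edges (rev p)
  ∈-edges-rev⁺ (step e p) (here refl) = edges-++ʷ⁺ʳ (rev p) _ (here refl)
  ∈-edges-rev⁺ (step e p) (there e∈)  = edges-++ʷ⁺ˡ (rev p) _ (∈-edges-rev⁺ p e∈)

  rev-⊑ : (p : Walk (adj G) u v) → edges (rev p) ⊑ edges p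
  rev-⊑ p e∈ = lose (∈-edges-rev⁻ p e∈) (swap-SameEdge _)

  ⊑-rev : (p : Walk (adj G) u v) → edges p ⊑ edges (rev p)
  ⊑-rev p e∈ = lose (∈-edges-rev⁺ p e∈) (swap-SameEdge _)

  trail-rev : (p : Walk (adj G) u v) → IsTrail p → IsTrail (rev p)
  trail-rev (here _)   _          = []
  trail-rev (step e p) (e# ∷ tp) =
    trail-++ʷ⁺ (rev p) _ (trail-rev p tp) (All.[] ∷ [])
      (EdgeDisjoint-anti (rev-⊑ p) (swap-⊑ _) (EdgeDisjoint-sym (All⇒EdgeDisjoint e#)))

  -- Of the two arcs of a circuit D between x and z, the one making the total even closes a trail K : z ⇝ x.
  evenClosing : (K : Walk (adj G) z x) (D : Walk (adj G) x x) → IsTrail (K ++ʷ D) → parity (len D) ≡ 1ℙ →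
    z ∈ verts D → Σ (Walk (adj G) z z) λ W → IsTrail W × parity (len W) ≡ 0ℙ × edges K ⊆ edges W
  evenClosing K D t odd z∈ with splitAt D z∈
  ... | D₁ , D₂ , refl with trail-++ʷ⁻ K (D₁ ++ʷ D₂) t
  ... | tK , tD , K#D with trail-++ʷ⁻ D₁ D₂ tD
  ... | tD₁ , tD₂ , _ with parity-even-choice (len K) (len D₁) (len D₂) (subst (λ l → parity l ≡ 1ℙ) (len-++ʷ D₁ D₂) odd)
  ... | inj₁ even₁ =
    K ++ʷ D₁ , trail-++ʷ⁺ K D₁ tK tD₁ (EdgeDisjoint-anti ⊑-refl (⊆⇒⊑ (edges-++ʷ⁺ˡ D₁ D₂)) K#D) ,
    subst (λ l → parity l ≡ 0ℙ) (≡.sym (len-++ʷ K D₁)) even₁ , edges-++ʷ⁺ˡ K D₁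
  ... | inj₂ even₂ =
    K ++ʷ rev D₂ ,
    trail-++ʷ⁺ K (rev D₂) tK (trail-rev D₂ tD₂)
      (EdgeDisjoint-anti ⊑-refl (⊑-trans (rev-⊑ D₂) (⊆⇒⊑ (edges-++ʷ⁺ʳ D₁ D₂))) K#D) ,
    subst (λ l → parity l ≡ 0ℙ) (≡.sym (trans (len-++ʷ K (rev D₂)) (cong (len K +_) (len-rev D₂)))) even₂ ,
    edges-++ʷ⁺ˡ K (rev D₂)

  arcThrough : ∀ {e} (C₁ : Walk (adj G) y w) (C₂ : Walk (adj G) w y) (P : Walk (adj G) y x) →
    IsTrail ((C₁ ++ʷ C₂) ++ʷ P) → Any (SameEdge e) (edges (C₁ ++ʷ C₂)) →
    Σ (Walk (adj G) w y) λ T → IsTrail (T ++ʷ P) × Any (SameEdge e) (edges T) × edges T ⊑ edges (C₁ ++ʷ C₂)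
  arcThrough C₁ C₂ P t e∈C with trail-++ʷ⁻ C₁ (C₂ ++ʷ P) (subst IsTrail (++ʷ-assoc C₁ C₂ P) t)
  ... | tC₁ , tC₂P , C₁#C₂P with Anyₚ.++⁻ (edges C₁) (subst (Any _) (edges-++ʷ C₁ C₂) e∈C)
  ... | inj₂ e∈C₂ = C₂ , tC₂P , e∈C₂ , ⊆⇒⊑ (edges-++ʷ⁺ʳ C₁ C₂)
  ... | inj₁ e∈C₁ with trail-++ʷ⁻ C₂ P tC₂P
  ...   | _ , tP , _ =
    rev C₁ ,
    trail-++ʷ⁺ (rev C₁) P (trail-rev C₁ tC₁) tP
      (EdgeDisjoint-anti (rev-⊑ C₁) (⊆⇒⊑ (edges-++ʷ⁺ʳ C₂ P)) C₁#C₂P) ,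
    Any-SameEdge-⊑ e∈C₁ (⊑-rev C₁) ,
    ⊑-trans (rev-⊑ C₁) (⊆⇒⊑ (edges-++ʷ⁺ˡ C₁ C₂))

module _ {n : ℕ} where

  sameEdge?-swap : (e f : Edge n) → ⌊ sameEdge? e f ⌋ ≡ ⌊ sameEdge? (swap e) f ⌋
  sameEdge?-swap (i , j) f with sameEdge? (i , j) f | sameEdge? (j , i) f
  ... | yes _ | yes _  = refl
  ... | no _  | no _   = refl
  ... | yes s | no ¬s  = ⊥-elim (¬s (SameEdge-swap s))
  ... | no ¬s | yes s  = ⊥-elim (¬s (SameEdge-swap s))

  ∧-not-⌊⌋⁻ : ∀ {P : Set} (x : Bool) (d : Dec P) → x ∧ not ⌊ d ⌋ ≡ true → x ≡ true × ¬ P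
  ∧-not-⌊⌋⁻ true (no ¬p) _ = refl , ¬p

  ∧-not-⌊⌋⁺ : ∀ {P : Set} {x : Bool} (d : Dec P) → x ≡ true → ¬ P → x ∧ not ⌊ d ⌋ ≡ true
  ∧-not-⌊⌋⁺ (yes p) _    ¬p = ⊥-elim (¬p p)
  ∧-not-⌊⌋⁺ (no _)  refl _  = refl

  infixl 6 _∖_
  _∖_ : Graph n → Edge n → Graph n
  G ∖ (a , b) = record
    { adj    = removeEdge a b (adj G)
    ; sym    = λ i j → begin
        removeEdge a b (adj G) i j                            ≡⟨ removeEdge-unfold a b (adj G) i j ⟩
        adj G i j ∧ not ⌊ sameEdge? (i , j) (a , b) ⌋         ≡⟨ cong₂ (λ x y → x ∧ not y) (Graph.sym G i j) (sameEdge?-swap (i , j) (a , b)) ⟩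
        adj G j i ∧ not ⌊ sameEdge? (j , i) (a , b) ⌋         ≡⟨ removeEdge-unfold a b (adj G) j i ⟨
        removeEdge a b (adj G) j i                            ∎
    ; irrefl = λ i → cong (_∧ _) (Graph.irrefl G i)
    }
    where open ≡-Reasoning

  module _ (G : Graph n) {a b : Fin n} where

    ∖-adj⁻ : ∀ {i j} → adj (G ∖ (a , b)) i j ≡ true → adj G i j ≡ true × ¬ SameEdge (i , j) (a , b)
    ∖-adj⁻ {i} {j} h = ∧-not-⌊⌋⁻ (adj G i j) (sameEdge? (i , j) (a , b)) (trans (≡.sym (removeEdge-unfold a b (adj G) i j)) h)

    ∖-adj⁺ : ∀ {i j} → adj G i j ≡ true → ¬ SameEdge (i , j) (a , b) → adj (G ∖ (a , b)) i j ≡ true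
    ∖-adj⁺ {i} {j} h ¬s = trans (removeEdge-unfold a b (adj G) i j) (∧-not-⌊⌋⁺ (sameEdge? (i , j) (a , b)) h ¬s)

    liftWalk : ∀ {u v} → Walk (adj (G ∖ (a , b))) u v → Walk (adj G) u v
    liftWalk = mapWalk (proj₁ ∘ ∖-adj⁻)

    liftWalk-trail : ∀ {u v} (p : Walk (adj (G ∖ (a , b))) u v) → IsTrail p → IsTrail (liftWalk p)
    liftWalk-trail p = subst Distinct (≡.sym (edges-mapWalk _ p))

    len-liftWalk : ∀ {u v} (p : Walk (adj (G ∖ (a , b))) u v) → len (liftWalk p) ≡ len p
    len-liftWalk p = cong length (edges-mapWalk _ p)

    liftWalk-avoids : ∀ {u v} (p : Walk (adj (G ∖ (a , b))) u v) → EdgeDisjoint (edges (liftWalk p)) ((a , b) ∷ [])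
    liftWalk-avoids (step e p) (here refl)  (here refl) = proj₂ (∖-adj⁻ e)
    liftWalk-avoids (step e p) (there f∈)   g∈          = liftWalk-avoids p f∈ g∈

module _ {n : ℕ} (G : Graph n) where

  ProperColouring : (Fin n → Parity) → Set
  ProperColouring col = ∀ {u v} → adj G u v ≡ true → col u ≢ col v

  walk-parity : ∀ {col} → ProperColouring col → ∀ {u v} (p : Walk (adj G) u v) → parity (len p) ≡ col u ℙ.+ col v
  walk-parity {col} proper (here v)           = ≡.sym (p+p≡0ℙ (col v))
  walk-parity {col} proper (step {u} {v} {w} e p) = begin
    parity (suc (len p))        ≡⟨ parity-suc (len p) ⟩
    parity (len p) ⁻¹           ≡⟨ cong _⁻¹ (walk-parity proper p) ⟩
    (col v ℙ.+ col w) ⁻¹        ≡⟨ cong (λ c → (c ℙ.+ col w) ⁻¹) (p≢q⇒q≡p⁻¹ (proper e)) ⟩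
    (col u ⁻¹ ℙ.+ col w) ⁻¹     ≡⟨ [p⁻¹+q]⁻¹≡p+q (col u) (col w) ⟩
    col u ℙ.+ col w             ∎
    where open ≡-Reasoning

  module _ (conn : Connected (adj G)) (r : Fin n) where

    private
      col : Fin n → Parity
      col v = parity (len (conn r v))

    -- Colour every vertex by the parity of the chosen walk to it from r; an edge joining two vertices
    -- of equal colour closes an odd walk.
    oddClosedWalk⊎colouring :
      (∃[ x ] Σ (Walk (adj G) x x) λ W → parity (len W) ≡ 1ℙ) ⊎ (∃[ c ] ProperColouring c × c r ≡ 0ℙ)
    oddClosedWalk⊎colouring with any? (λ u → any? (λ v → (adj G u v Bool.≟ true) ×-dec (col u ℙ.≟ col v)))
    ... | no none = inj₂ (col , proper , trans (walk-parity proper (conn r r)) (p+p≡0ℙ (col r)))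
      where
      proper : ProperColouring col
      proper {u} {v} e same = none (u , v , e , same)
    ... | yes (u , v , e , same) = inj₁ (r , W , odd)
      where
      W = conn r u ++ʷ step e (rev G (conn r v))
      odd : parity (len W) ≡ 1ℙ
      odd = begin
        parity (len W)                                          ≡⟨ cong parity (len-++ʷ (conn r u) _) ⟩
        parity (len (conn r u) + suc (len (rev G (conn r v))))  ≡⟨ +-homo-+ (len (conn r u)) _ ⟩
        col u ℙ.+ parity (suc (len (rev G (conn r v))))         ≡⟨ cong (col u ℙ.+_) (parity-suc (len (rev G (conn r v)))) ⟩
        col u ℙ.+ parity (len (rev G (conn r v))) ⁻¹            ≡⟨ cong (λ l → col u ℙ.+ parity l ⁻¹) (len-rev G (conn r v)) ⟩
        col u ℙ.+ col v ⁻¹                                      ≡⟨ cong (λ c → col u ℙ.+ c ⁻¹) same ⟨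
        col u ℙ.+ col u ⁻¹                                      ≡⟨ p+p⁻¹≡1ℙ (col u) ⟩
        1ℙ                                                      ∎
        where open ≡-Reasoning

𝟙 : Bool → ℕ
𝟙 b = if b then 1 else 0

listSum-tabulate : ∀ {m} (f : Fin m → ℕ) → ListAction.sum (tabulate f) ≡ ∑[ i < m ] f i
listSum-tabulate {zero}  f = refl
listSum-tabulate {suc m} f = cong (f zero +_) (listSum-tabulate (f ∘ suc))

isYes≡ : ∀ {P : Set} (d : Dec P) → P → ⌊ d ⌋ ≡ true
isYes≡ d p = trans (isYes≗does d) (dec-true d p)

isNo≡ : ∀ {P : Set} (d : Dec P) → ¬ P → ⌊ d ⌋ ≡ false
isNo≡ d ¬p = trans (isYes≗does d) (dec-false d ¬p)

∑-δ : ∀ {n} (t : Fin n) → ∑[ u < n ] 𝟙 ⌊ u ≟ t ⌋ ≡ 1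
∑-δ {suc m} t = begin
  ∑[ u < suc m ] 𝟙 ⌊ u ≟ t ⌋                     ≡⟨ sum-remove {i = t} (λ u → 𝟙 ⌊ u ≟ t ⌋) ⟩
  𝟙 ⌊ t ≟ t ⌋ + ∑[ j < m ] 𝟙 ⌊ punchIn t j ≟ t ⌋  ≡⟨ cong₂ _+_ (cong 𝟙 (isYes≡ (t ≟ t) refl)) (sum-cong-≗ λ j → cong 𝟙 (isNo≡ (punchIn t j ≟ t) (punchInᵢ≢i t j))) ⟩
  1 + ∑[ j < m ] 0                               ≡⟨ cong (1 +_) (sum-replicate-zero m) ⟩
  1                                              ∎
  where open ≡-Reasoning

∣-∑ : ∀ {k m} (f : Fin m → ℕ) → (∀ i → k ∣ f i) → k ∣ ∑[ i < m ] f i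
∣-∑ {k} {zero}  f _   = k ∣0
∣-∑ {k} {suc m} f k∣f = ∣m∣n⇒∣m+n (k∣f zero) (∣-∑ (f ∘ suc) (k∣f ∘ suc))

module _ {n : ℕ} (G : Graph n) where

  deg-∑ : ∀ v → deg G v ≡ ∑[ u < n ] 𝟙 (adj G v u)
  deg-∑ v = trans (cong ListAction.sum (map-tabulate id (λ u → 𝟙 (adj G v u)))) (listSum-tabulate (λ u → 𝟙 (adj G v u)))

  module _ {a b : Fin n} (a≢b : a ≢ b) where

    𝟙-sameEdge : ∀ v u → 𝟙 ⌊ sameEdge? (v , u) (a , b) ⌋ ≡ 𝟙 ⌊ v ≟ a ⌋ * 𝟙 ⌊ u ≟ b ⌋ + 𝟙 ⌊ v ≟ b ⌋ * 𝟙 ⌊ u ≟ a ⌋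
    𝟙-sameEdge v u with v ≟ a | v ≟ b | u ≟ b | u ≟ a
    ... | yes refl | yes v≡b  | _        | _        = ⊥-elim (a≢b v≡b)
    ... | _        | _        | yes refl | yes u≡a  = ⊥-elim (a≢b (≡.sym u≡a))
    ... | yes _    | no _     | yes _    | no _     = refl
    ... | yes _    | no _     | no _     | yes _    = refl
    ... | yes _    | no _     | no _     | no _     = refl
    ... | no _     | yes _    | yes _    | no _     = refl
    ... | no _     | yes _    | no _     | yes _    = refl
    ... | no _     | yes _    | no _     | no _     = refl
    ... | no _     | no _     | yes _    | no _     = refl
    ... | no _     | no _     | no _     | yes _    = refl
    ... | no _     | no _     | no _     | no _     = refl

    ∑∑-sameEdge : ∑[ v < n ] ∑[ u < n ] 𝟙 ⌊ sameEdge? (v , u) (a , b) ⌋ ≡ 2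
    ∑∑-sameEdge = begin
      ∑[ v < n ] ∑[ u < n ] 𝟙 ⌊ sameEdge? (v , u) (a , b) ⌋
        ≡⟨ sum-cong-≗ (λ v → trans (sum-cong-≗ (𝟙-sameEdge v)) (∑-distrib-+ (λ u → is a v * is b u) (λ u → is b v * is a u))) ⟩
      ∑[ v < n ] (∑[ u < n ] (is a v * is b u) + ∑[ u < n ] (is b v * is a u))
        ≡⟨ sum-cong-≗ (λ v → cong₂ _+_ (pick (is a v) b) (pick (is b v) a)) ⟩
      ∑[ v < n ] (is a v + is b v)
        ≡⟨ ∑-distrib-+ (is a) (is b) ⟩
      ∑[ v < n ] is a v + ∑[ v < n ] is b v
        ≡⟨ cong₂ _+_ (∑-δ a) (∑-δ b) ⟩
      2 ∎
      where
      open ≡-Reasoning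
      is : Fin n → Fin n → ℕ
      is t u = 𝟙 ⌊ u ≟ t ⌋
      pick : ∀ c t → ∑[ u < n ] (c * is t u) ≡ c
      pick c t = trans (≡.sym (*-distribˡ-sum c (is t))) (trans (cong (c *_) (∑-δ t)) (*-identityʳ c))

  -- Counting edge ends at each colour class: every edge crosses between the classes except ab,
  -- whose two ends both lie in class 0ℙ.
  degreeSum-colourClasses : ∀ {a b} (col : Fin n → Parity) → ProperColouring (G ∖ (a , b)) col →
    adj G a b ≡ true → col a ≡ 0ℙ → col b ≡ 0ℙ →
    ∑[ v < n ] (𝟙 ⌊ col v ℙ.≟ 0ℙ ⌋ * deg G v) ≡ ∑[ v < n ] (𝟙 ⌊ col v ℙ.≟ 1ℙ ⌋ * deg G v) + 2
  degreeSum-colourClasses {a} {b} col proper ab ca cb = begin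
    ∑[ v < n ] (in₀ v * deg G v)
      ≡⟨ sum-cong-≗ (λ v → trans (cong (in₀ v *_) (deg-∑ v)) (*-distribˡ-sum (in₀ v) (A v))) ⟩
    ∑[ v < n ] ∑[ u < n ] (in₀ v * A v u)
      ≡⟨ sum-cong-≗ (λ v → trans (sum-cong-≗ (pointwise v)) (∑-distrib-+ (λ u → in₁ u * A v u) (δ v))) ⟩
    ∑[ v < n ] (∑[ u < n ] (in₁ u * A v u) + ∑[ u < n ] δ v u)
      ≡⟨ ∑-distrib-+ (λ v → ∑[ u < n ] (in₁ u * A v u)) (λ v → ∑[ u < n ] δ v u) ⟩
    ∑[ v < n ] ∑[ u < n ] (in₁ u * A v u) + ∑[ v < n ] ∑[ u < n ] δ v u
      ≡⟨ cong₂ _+_ (∑-comm (λ v u → in₁ u * A v u)) (∑∑-sameEdge (adj⇒≢ G ab)) ⟩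
    ∑[ u < n ] ∑[ v < n ] (in₁ u * A v u) + 2
      ≡⟨ cong (_+ 2) (sum-cong-≗ regroup) ⟩
    ∑[ u < n ] (in₁ u * deg G u) + 2 ∎
    where
    open ≡-Reasoning
    in₀ in₁ : Fin n → ℕ
    in₀ v = 𝟙 ⌊ col v ℙ.≟ 0ℙ ⌋
    in₁ v = 𝟙 ⌊ col v ℙ.≟ 1ℙ ⌋
    A δ : Fin n → Fin n → ℕ
    A v u = 𝟙 (adj G v u)
    δ v u = 𝟙 ⌊ sameEdge? (v , u) (a , b) ⌋
    regroup : ∀ u → ∑[ v < n ] (in₁ u * A v u) ≡ in₁ u * deg G u
    regroup u = begin
      ∑[ v < n ] (in₁ u * A v u)  ≡⟨ sum-cong-≗ (λ v → cong (λ x → in₁ u * 𝟙 x) (Graph.sym G v u)) ⟩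
      ∑[ v < n ] (in₁ u * A u v)  ≡⟨ *-distribˡ-sum (in₁ u) (A u) ⟨
      in₁ u * ∑[ v < n ] A u v    ≡⟨ cong (in₁ u *_) (deg-∑ u) ⟨
      in₁ u * deg G u             ∎
    pointwise : ∀ v u → in₀ v * A v u ≡ in₁ u * A v u + δ v u
    pointwise v u with sameEdge? (v , u) (a , b)
    ... | yes (inj₁ (refl , refl)) rewrite ab | ca | cb = refl
    ... | yes (inj₂ (refl , refl)) rewrite adj-sym G ab | ca | cb = refl
    ... | no ¬ab with adj G v u in vu | col v in cv | col u in cu
    ...   | false | 0ℙ | 0ℙ = refl
    ...   | false | 0ℙ | 1ℙ = refl
    ...   | false | 1ℙ | 0ℙ = refl
    ...   | false | 1ℙ | 1ℙ = refl
    ...   | true  | 0ℙ | 1ℙ = refl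
    ...   | true  | 1ℙ | 0ℙ = refl
    ...   | true  | 0ℙ | 0ℙ = ⊥-elim (proper (∖-adj⁺ G vu ¬ab) (trans cv (≡.sym cu)))
    ...   | true  | 1ℙ | 1ℙ = ⊥-elim (proper (∖-adj⁺ G vu ¬ab) (trans cv (≡.sym cu)))

  degreesDivisible⇒∣2 : ∀ {a b k} (col : Fin n → Parity) → ProperColouring (G ∖ (a , b)) col →
    adj G a b ≡ true → col a ≡ 0ℙ → col b ≡ 0ℙ → (∀ v → k ∣ deg G v) → k ∣ 2
  degreesDivisible⇒∣2 {k = k} col proper ab ca cb k∣deg =
    ∣m+n∣m⇒∣n (subst (k ∣_) (degreeSum-colourClasses col proper ab ca cb) (classSum-divisible 0ℙ)) (classSum-divisible 1ℙ)
    where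
    classSum-divisible : ∀ c → k ∣ ∑[ v < n ] (𝟙 ⌊ col v ℙ.≟ c ⌋ * deg G v)
    classSum-divisible c = ∣-∑ _ (λ v → ∣n⇒∣m*n (𝟙 ⌊ col v ℙ.≟ c ⌋) (k∣deg v))

module EvenCircuit {n : ℕ} (G : Graph n)
  (bridgeless : ∀ p q → adj G p q ≡ true → Connected (adj (G ∖ (p , q))))
  {a b : Fin n} (ab : adj G a b ≡ true) where

  open DecMembership (_≟_ {n}) using (_∈?_)

  private
    W : Fin n → Fin n → Set
    W = Walk (adj G)

  Through : List (Edge n) → Set
  Through = Any (SameEdge (a , b))

  EvenCircuitThrough : Set
  EvenCircuitThrough = Σ (Circuit G) λ c → OnCircuit a b c × 2 ∣ circuitLength c

  closeThroughOddCircuit : ∀ {z x} (K : W z x) (D : W x x) → IsTrail (K ++ʷ D) → Through (edges K) →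
    parity (len D) ≡ 1ℙ → z ∈ verts D → EvenCircuitThrough
  closeThroughOddCircuit {z} K D t thr odd z∈ with evenClosing G K D t odd z∈
  ... | C , tC , even , K⊆C =
    record { base = z ; walk = C ; trail = tC } , Any-SameEdge-⊑ thr (⊆⇒⊑ K⊆C) , parity≡0ℙ⇒2∣ (len C) even

  -- A circuit C through ab joined by a bar Q to an odd circuit D; asking C ++ Q ++ D to be a single
  -- trail makes the three pieces edge-disjoint.
  record Dumbbell : Set where
    constructor dumbbell
    field
      {y x}   : Fin n
      C       : W y y
      Q       : W y x
      D       : W x x
      trail   : IsTrail (C ++ʷ Q ++ʷ D)
      through : Through (edges C)
      odd     : parity (len D) ≡ 1ℙ

  through-++ʷ : ∀ {z w y q u} (R : W z w) (T : W w y) (E : W y q) (X : W q u) →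
    Through (edges T) → Through (edges ((R ++ʷ T ++ʷ E) ++ʷ X))
  through-++ʷ R T E X thr =
    Any-SameEdge-⊑ thr (⊆⇒⊑ (edges-++ʷ⁺ˡ (R ++ʷ T ++ʷ E) X ∘ edges-++ʷ⁺ʳ R (T ++ʷ E) ∘ edges-++ʷ⁺ˡ T E))

  -- R leads from D or from the part Q₀ of the bar E ++ Q₀ to an arc T through ab: from D, an arc of D
  -- closes an even circuit; from Q₀, it splits off a strictly shorter bar.
  reroute : ∀ {z w y q x} (R : W z w) (T : W w y) (E : W y q) (Q₀ : W q x) (D : W x x) →
    IsTrail (R ++ʷ T ++ʷ E ++ʷ Q₀ ++ʷ D) → Through (edges T) → parity (len D) ≡ 1ℙ →
    z ∈ verts (Q₀ ++ʷ D) →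
    EvenCircuitThrough ⊎ Σ Dumbbell λ B → len (Dumbbell.Q B) ≤ len Q₀
  reroute R T E Q₀ D t thr odd z∈ with ∈-verts-++ʷ⁻ Q₀ D z∈
  ... | inj₂ z∈D =
    inj₁ (closeThroughOddCircuit ((R ++ʷ T ++ʷ E) ++ʷ Q₀) D (subst IsTrail (≡.sym reassoc) t)
           (through-++ʷ R T E Q₀ thr) odd z∈D)
    where
    reassoc : ((R ++ʷ T ++ʷ E) ++ʷ Q₀) ++ʷ D ≡ R ++ʷ T ++ʷ E ++ʷ Q₀ ++ʷ D
    reassoc = trans (++ʷ-assoc (R ++ʷ T ++ʷ E) Q₀ D) (++ʷ-assoc³ R T E (Q₀ ++ʷ D))
  ... | inj₁ z∈Q₀ with splitAt Q₀ z∈Q₀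
  ...   | Qa , Qb , refl =
    inj₂ (dumbbell (H ++ʷ Qa) Qb D (subst IsTrail (≡.sym reassoc) t) (through-++ʷ R T E Qa thr) odd ,
          ≤-trans (m≤n+m (len Qb) (len Qa)) (≤-reflexive (≡.sym (len-++ʷ Qa Qb))))
    where
    H = R ++ʷ T ++ʷ E
    reassoc : (H ++ʷ Qa) ++ʷ Qb ++ʷ D ≡ R ++ʷ T ++ʷ E ++ʷ (Qa ++ʷ Qb) ++ʷ D
    reassoc = begin
      (H ++ʷ Qa) ++ʷ Qb ++ʷ D              ≡⟨ ++ʷ-assoc H Qa (Qb ++ʷ D) ⟩
      H ++ʷ Qa ++ʷ Qb ++ʷ D                ≡⟨ cong (H ++ʷ_) (++ʷ-assoc Qa Qb D) ⟨
      H ++ʷ (Qa ++ʷ Qb) ++ʷ D              ≡⟨ ++ʷ-assoc³ R T E ((Qa ++ʷ Qb) ++ʷ D) ⟩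
      R ++ʷ T ++ʷ E ++ʷ (Qa ++ʷ Qb) ++ʷ D  ∎
      where open ≡-Reasoning

  fromDumbbell : ∀ m (B : Dumbbell) → len (Dumbbell.Q B) ≤ m → EvenCircuitThrough
  fromDumbbell _ (dumbbell C (here _) D t thr odd) _ = closeThroughOddCircuit C D t thr odd (start∈verts D)
  -- The first edge yq of the bar is no bridge; a detour from x avoiding it, cut down to its stretch
  -- between its last visit to Q₀ ++ D and its first visit to C, is the R of reroute.
  fromDumbbell (suc m) (dumbbell {y} {x} C (step {v = q} f Q₀) D t thr odd) (s≤s ≤m)
    with firstHit (_∈? verts C) (liftWalk G (bridgeless y q f x y)) (start∈verts C)
  ... | w , w∈C , R₁ , R₁-out , R₁⊆
    with lastHit (_∈? verts (Q₀ ++ʷ D)) R₁ (∈-verts-++ʷ⁺ʳ Q₀ D (start∈verts D))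
  ... | z , z∈ , R₂ , R₂-out , R₂⊆ with shortcut R₂
  ... | R , R-path , R⊆ with splitAt C w∈C
  ... | C₁ , C₂ , refl with arcThrough G C₁ C₂ (step f Q₀ ++ʷ D) t thr
  ... | T , tT , thrT , T⊑C =
    [ id , (λ (B , ≤Q₀) → fromDumbbell m B (≤-trans ≤Q₀ ≤m)) ]′
      (reroute R T (step f (here q)) Q₀ D trail′ thrT odd z∈)
    where
    R#T : EdgeDisjoint (edges R) (edges T)
    R#T = sources-outside⇒EdgeDisjoint (λ e∈ → R₁-out (R₂⊆ (R⊆ e∈))) (Inside-⊑ T⊑C (edges-inside-verts (C₁ ++ʷ C₂)))
    R#yq : EdgeDisjoint (edges R) ((y , q) ∷ [])
    R#yq = EdgeDisjoint-anti (⊆⇒⊑ (R₁⊆ ∘ R₂⊆ ∘ R⊆)) ⊑-refl (liftWalk-avoids G (bridgeless y q f x y))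
    R#Q₀D : EdgeDisjoint (edges R) (edges (Q₀ ++ʷ D))
    R#Q₀D = targets-outside⇒EdgeDisjoint (λ e∈ → R₂-out (R⊆ e∈)) (edges-inside-verts (Q₀ ++ʷ D))
    trail′ : IsTrail (R ++ʷ T ++ʷ step f (here q) ++ʷ Q₀ ++ʷ D)
    trail′ = trail-++ʷ⁺ R (T ++ʷ step f (Q₀ ++ʷ D)) (path⇒trail R R-path) tT
               (EdgeDisjoint-++ʷʳ T _ R#T (EdgeDisjoint-++ʳ R#yq R#Q₀D))

  private
    detour : ∀ u v → W u v
    detour u v = liftWalk G (bridgeless a b ab u v)

    detour-avoids : ∀ u v → EdgeDisjoint (edges (detour u v)) ((a , b) ∷ [])
    detour-avoids u v = liftWalk-avoids G (bridgeless a b ab u v)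

  -- The first dumbbell: the bar Q runs in G ∖ ab from a to D, and the edge ba serves as the arc.
  fromOddCircuit : ∀ {d} (D₀ : W d d) → IsTrail D₀ → parity (len D₀) ≡ 1ℙ →
    EdgeDisjoint (edges D₀) ((a , b) ∷ []) → EvenCircuitThrough
  fromOddCircuit {d} D₀ tD₀ odd₀ D₀#ab
    with firstHit (_∈? verts D₀) (detour a d) (start∈verts D₀)
  ... | x , x∈D₀ , Q₁ , Q₁-out , Q₁⊆ with shortcut Q₁
  ... | Q , Q-path , Q⊆ with rotate D₀ tD₀ x∈D₀
  ... | D , tD , lenD , D⊆ with lastHit (_∈? verts (Q ++ʷ D)) (detour x b) (∈-verts-++ʷ⁺ʳ Q D (start∈verts D))
  ... | z , z∈ , R₂ , R₂-out , R₂⊆ with shortcut R₂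
  ... | R , R-path , R⊆ =
    [ id , (λ (B , _) → fromDumbbell _ B ≤-refl) ]′
      (reroute R ba (here a) Q D trail′ (here (inj₂ (refl , refl))) (trans (cong parity lenD) odd₀) z∈)
    where
    ba = step (adj-sym G ab) (here a)
    Q#D : EdgeDisjoint (edges Q) (edges D)
    Q#D = sources-outside⇒EdgeDisjoint (λ e∈ → Q₁-out (Q⊆ e∈)) (Inside-⊑ (⊆⇒⊑ D⊆) (edges-inside-verts D₀))
    QD#ab : EdgeDisjoint (edges (Q ++ʷ D)) ((a , b) ∷ [])
    QD#ab = EdgeDisjoint-sym (EdgeDisjoint-++ʷʳ Q D
              (EdgeDisjoint-sym (EdgeDisjoint-anti (⊆⇒⊑ (Q₁⊆ ∘ Q⊆)) ⊑-refl (detour-avoids a d)))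
              (EdgeDisjoint-sym (EdgeDisjoint-anti (⊆⇒⊑ D⊆) ⊑-refl D₀#ab)))
    R#ba : EdgeDisjoint (edges R) (edges ba)
    R#ba = EdgeDisjoint-anti (⊆⇒⊑ (R₂⊆ ∘ R⊆)) (swap-⊑ (a , b)) (detour-avoids x b)
    trail′ : IsTrail (R ++ʷ ba ++ʷ here a ++ʷ Q ++ʷ D)
    trail′ = trail-++ʷ⁺ R (ba ++ʷ Q ++ʷ D) (path⇒trail R R-path)
      (All.tabulate (λ e∈ s → QD#ab e∈ (here refl) (SameEdge-sym (SameEdge-swap s)))
        ∷ trail-++ʷ⁺ Q D (path⇒trail Q Q-path) tD Q#D)
      (EdgeDisjoint-++ʳ R#ba (targets-outside⇒EdgeDisjoint (λ e∈ → R₂-out (R⊆ e∈)) (edges-inside-verts (Q ++ʷ D))))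

  fromOddPath : (P : W b a) → IsTrail P → EdgeDisjoint (edges P) ((a , b) ∷ []) → parity (len P) ≡ 1ℙ →
    EvenCircuitThrough
  fromOddPath P tP P#ab odd =
    record { base = a ; walk = step ab P ; trail = All.tabulate (λ e∈ s → P#ab e∈ (here refl) (SameEdge-sym s)) ∷ tP } ,
    here (inj₁ (refl , refl)) ,
    parity≡0ℙ⇒2∣ (suc (len P)) (trans (parity-suc (len P)) (cong _⁻¹ odd))

  fromOddClosedWalk : ∀ {x} (Wᴴ : Walk (adj (G ∖ (a , b))) x x) → parity (len Wᴴ) ≡ 1ℙ → EvenCircuitThrough
  fromOddClosedWalk Wᴴ odd with oddClosedTrail Wᴴ odd
  ... | _ , D , tD , oddD =
    fromOddCircuit (liftWalk G D) (liftWalk-trail G D tD) (trans (cong parity (len-liftWalk G D)) oddD) (liftWalk-avoids G D)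

  fromSeparatingColouring : ∀ col → ProperColouring (G ∖ (a , b)) col → col b ≡ 0ℙ → col a ≡ 1ℙ → EvenCircuitThrough
  fromSeparatingColouring col proper cb ca with shortcut (bridgeless a b ab b a)
  ... | P , P-path , _ =
    fromOddPath (liftWalk G P) (liftWalk-trail G P (path⇒trail P P-path)) (liftWalk-avoids G P)
      (trans (cong parity (len-liftWalk G P)) (trans (walk-parity (G ∖ (a , b)) proper P) (cong₂ ℙ._+_ cb ca)))

  evenCircuitThrough : ∀ {k} → 3 ≤ k → (∀ v → k ∣ deg G v) → EvenCircuitThrough
  evenCircuitThrough 3≤k k∣deg with oddClosedWalk⊎colouring (G ∖ (a , b)) (bridgeless a b ab) b
  ... | inj₁ (_ , Wᴴ , odd) = fromOddClosedWalk Wᴴ odd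
  ... | inj₂ (col , proper , col-b) with col a in col-a
  ...   | 1ℙ = fromSeparatingColouring col proper col-b col-a
  ...   | 0ℙ = ⊥-elim (3≰2 (≤-trans 3≤k (∣⇒≤ (degreesDivisible⇒∣2 G col proper ab col-a col-b k∣deg))))
    where
    3≰2 : ¬ 3 ≤ 2
    3≰2 (s≤s (s≤s ()))

theorem7 : (n : ℕ) (G : Graph n) (k : ℕ) → 3 ≤ k → TwoEdgeConnected G →
           (∀ v → k ∣ deg G v) →
           ∀ a b → adj G a b ≡ true →
           Σ (Circuit G) (λ c → OnCircuit a b c × 2 ∣ circuitLength c)
theorem7 n G k 3≤k (_ , bridgeless) k∣deg a b ab = EvenCircuit.evenCircuitThrough G bridgeless ab 3≤k k∣deg
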